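{- The lower comparability switching class is equal to the lower $\{C_5,\overline{C_6}\}$-free switching class.
   Context: All graphs are finite and simple. For a graph $G$ and $A\subseteq V(G)$, the switching $S(G,A)$ is the graph on $V(G)$ whose edges are the edges of $G$ with both ends in $A$, the edges of $G$ with both ends outside $A$, and all pairs $uv$ with $u\in A$, $v\notin A$, $uv\notin E(G)$. For a graph class $\mathcal{G}$, the lower $\mathcal{G}$ switching class is the class of graphs $G$ such that $S(G,A)\in\mathcal{G}$ for every $A\subseteq V(G)$. A graph is a comparability graph if its edges can be oriented transitively (arcs $xy$ and $yz$ force the arc $xz$). $\{C_5,\overline{C_6}\}$-free graphs are those with no induced 5-cycle and no induced complement of the 6-cycle. -}

module Defs where

open import Data.Nat using (ℕ; suc; _%_; _≡ᵇ_)
open import Data.Fin using (Fin; toℕ)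
open import Data.Bool using (Bool; true; false; not; _∧_; _∨_; if_then_else_)
open import Data.Product using (Σ; _×_; ∃)
open import Data.Sum using (_⊎_)
open import Relation.Binary.PropositionalEquality using (_≡_)
open import Relation.Nullary using (¬_)
open import Function.Definitions using (Injective)
open import Level using (0ℓ)

record Graph (n : ℕ) : Set where
  field
    adj   : Fin n → Fin n → Bool
    sym   : ∀ u v → adj u v ≡ adj v u
    irrfl : ∀ v → adj v v ≡ false
open Graph public

VSet : ℕ → Set
VSet n = Fin n → Bool

sameSide : ∀ {n} → VSet n → Fin n → Fin n → Bool
sameSide A u v = if A u then A v else not (A v)

switchAdj : ∀ {n} → Graph n → VSet n → Fin n → Fin n → Bool
switchAdj G A u v = if sameSide A u v then adj G u v else not (adj G u v)

switch : ∀ {n} → Graph n → VSet n → Graph n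
switch G A = record { adj = switchAdj G A ; sym = symP ; irrfl = irrP }
  where
  sameSym : ∀ u v → sameSide A u v ≡ sameSide A v u
  sameSym u v with A u | A v
  ... | true  | true  = _≡_.refl
  ... | true  | false = _≡_.refl
  ... | false | true  = _≡_.refl
  ... | false | false = _≡_.refl
  symP : ∀ u v → switchAdj G A u v ≡ switchAdj G A v u
  symP u v with sameSide A u v | sameSide A v u | sameSym u v | sym G u v
  ... | true  | .true  | _≡_.refl | e = e
  ... | false | .false | _≡_.refl | e = Relation.Binary.PropositionalEquality.cong not e
    where import Relation.Binary.PropositionalEquality
  sameRefl : ∀ v → sameSide A v v ≡ true
  sameRefl v with A v
  ... | true  = _≡_.refl
  ... | false = _≡_.refl
  irrP : ∀ v → switchAdj G A v v ≡ false
  irrP v rewrite sameRefl v = irrfl G v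

GraphClass : Set₁
GraphClass = ∀ {n} → Graph n → Set

LowerSwitching : GraphClass → GraphClass
LowerSwitching 𝒢 G = ∀ (A : VSet _) → 𝒢 (switch G A)

record TransitiveOrientation {n : ℕ} (G : Graph n) : Set where
  field
    arc      : Fin n → Fin n → Bool
    arc⇒edge : ∀ u v → arc u v ≡ true → adj G u v ≡ true
    edge⇒arc : ∀ u v → adj G u v ≡ true → (arc u v ≡ true) ⊎ (arc v u ≡ true)
    antisym  : ∀ u v → arc u v ≡ true → arc v u ≡ false
    trans    : ∀ x y z → arc x y ≡ true → arc y z ≡ true → arc x z ≡ true

Comparability : GraphClass
Comparability G = TransitiveOrientation G

InducedCopy : ∀ {m n} → (Fin m → Fin m → Bool) → Graph n → Set
InducedCopy {m} {n} h G =
  Σ (Fin m → Fin n) λ f → Injective _≡_ _≡_ f × (∀ i j → adj G (f i) (f j) ≡ h i j)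

C5adj : Fin 5 → Fin 5 → Bool
C5adj i j = (suc (toℕ i) % 5 ≡ᵇ toℕ j) ∨ (suc (toℕ j) % 5 ≡ᵇ toℕ i)

C6adj : Fin 6 → Fin 6 → Bool
C6adj i j = (suc (toℕ i) % 6 ≡ᵇ toℕ j) ∨ (suc (toℕ j) % 6 ≡ᵇ toℕ i)

coC6adj : Fin 6 → Fin 6 → Bool
coC6adj i j = not (C6adj i j) ∧ not (toℕ i ≡ᵇ toℕ j)

C5coC6Free : GraphClass
C5coC6Free G = ¬ InducedCopy C5adj G × ¬ InducedCopy coC6adj G

-- Comparability graphs contain no induced C₅ and no induced prism C̄₆: at the middle vertex of an
-- induced path a – b – c the two arcs both point in or both point out, and this alternation cannot
-- close up around either graph.
--
-- Conversely, suppose every switching of G is {C₅, C̄₆}-free; as the switchings of a switching of G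
-- are switchings of G, it suffices to orient G itself. Switching G at the neighbourhood of a vertex
-- v isolates v. Since P₄ + K₁ switches to C₅, and C₄ + 2K₁ and K₂,₂,₂ switch to the prism, the
-- graph H in which v₀ is isolated is P₄-free and K₂,₂,₂-free, and every vertex other than v₀ has a
-- neighbour on each induced C₄ of H. For w ≠ v₀ with inclusion-minimal closed neighbourhood in H, a
-- case analysis on which vertices of a C₄ lie in N(w) shows that the graph K in which w is isolated
-- is C₄-free as well as P₄-free. In such a graph adjacent vertices have nested closed
-- neighbourhoods, so directing each edge towards the larger one (ties broken by index) is
-- transitive. As G is K switched at N(w), keeping this orientation outside N(w), reversing it
-- inside N(w) and directing every other edge of G into N(w) orients G transitively.

module Submission where

open import Defs hiding (sym)

open import Algebra.Solver.Ring.AlmostCommutativeRing using (fromCommutativeRing)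
open import Data.Bool using (Bool; true; false; not; if_then_else_; _xor_)
open import Data.Bool.Properties
  using (xor-∧-commutativeRing; xor-identityʳ; xor-comm; xor-same; ¬-not; not-injective)
  renaming (_≟_ to _≟ᵇ_)
open import Data.Empty using (⊥; ⊥-elim)
open import Data.Fin using (Fin; zero; suc; toℕ; _<_; _≟_)
open import Data.Fin.Patterns
open import Data.Fin.Properties using (<-cmp; <-asym; <-trans; <-irrefl; _<?_; all?; any?; ¬∀⟶∃¬)
open import Data.Fin.Subset using (Subset; ∣_∣) renaming (_∈_ to _∈ₛ_)
open import Data.Fin.Subset.Properties using (p⊂q⇒∣p∣<∣q∣)
open import Data.List using (List; []; _∷_; _++_; map; allFin)
open import Data.List.Membership.Propositional using (_∈_)
open import Data.List.Membership.Propositional.Properties using (∈-++⁺ˡ; ∈-++⁺ʳ; ∈-map⁺; ∈-allFin)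
open import Data.List.Relation.Unary.All as All using (All; []; _∷_)
open import Data.List.Relation.Unary.All.Properties using (All¬⇒¬Any)
open import Data.List.Relation.Unary.Any as Any using (here; there)
open import Data.Nat using (ℕ; zero; suc; s≤s; _%_; _≡ᵇ_) renaming (_<_ to _<ℕ_; _≤_ to _≤ℕ_)
open import Data.Nat.Properties using (≤-totalOrder; <⇒≱)
open import Data.List.Extrema ≤-totalOrder using (argmin; f[argmin]≤f[xs])
open import Data.Product as Product using (_×_; _,_; proj₁; proj₂; ∃; uncurry)
open import Data.Sum as Sum using (_⊎_; inj₁; inj₂; [_,_])
open import Data.Vec using (tabulate)
open import Data.Vec.Properties using (lookup∘tabulate; lookup⇒[]=; []=⇒lookup)
open import Function using (_∘_; const)
open import Function.Bundles using (_⇔_; mk⇔)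
open import Function.Definitions using (Injective)
open import Relation.Binary using (tri<; tri≈; tri>)
open import Relation.Binary.PropositionalEquality
  using (_≡_; _≢_; refl; sym; trans; cong; cong₂; subst; ≢-sym; module ≡-Reasoning)
open import Relation.Nullary using (¬_; Dec; yes; no; does; ¬?)
open import Relation.Nullary.Decidable
  using (decidable-stable; _×-dec_; _⊎-dec_; _→-dec_; dec-true; dec-false; from-yes)

open import Algebra.Solver.Ring.Simple (fromCommutativeRing xor-∧-commutativeRing) _≟ᵇ_
  using (solve; _:+_; _:=_)

private variable
  n m : ℕ

infix 4 _⊢_~_ _⊢_≁_ _≈_

_⊢_~_ _⊢_≁_ : Graph n → Fin n → Fin n → Set
G ⊢ u ~ v = adj G u v ≡ true
G ⊢ u ≁ v = adj G u v ≡ false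

module _ (G : Graph n) where

  ~-sym : ∀ {u v} → G ⊢ u ~ v → G ⊢ v ~ u
  ~-sym {u} {v} = trans (Graph.sym G v u)

  ≁-sym : ∀ {u v} → G ⊢ u ≁ v → G ⊢ v ≁ u
  ≁-sym {u} {v} = trans (Graph.sym G v u)

  ~-≁-contradiction : ∀ {u v} → G ⊢ u ~ v → G ⊢ u ≁ v → ⊥
  ~-≁-contradiction uv uv′ with trans (sym uv) uv′
  ... | ()

  ~⇒≢ : ∀ {u v} → G ⊢ u ~ v → u ≢ v
  ~⇒≢ {u} uv refl = ~-≁-contradiction uv (irrfl G u)

  ~≁⇒≢ : ∀ {z u v} → G ⊢ z ~ u → G ⊢ z ≁ v → u ≢ v
  ~≁⇒≢ zu zv refl = ~-≁-contradiction zu zv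

_≈_ : Graph n → Graph n → Set
G ≈ H = ∀ u v → adj G u v ≡ adj H u v

-- Switching

_⊕_ : VSet n → VSet n → VSet n
(A ⊕ B) z = A z xor B z

adj-switch : ∀ (G : Graph n) A u v → adj (switch G A) u v ≡ adj G u v xor (A u xor A v)
adj-switch G A u v with A u | A v
... | true  | true  = sym (xor-identityʳ _)
... | true  | false = sym (xor-comm (adj G u v) true)
... | false | true  = sym (xor-comm (adj G u v) true)
... | false | false = sym (xor-identityʳ _)

xor-cancelʳ : ∀ a c → (a xor c) xor c ≡ a
xor-cancelʳ = solve 2 (λ a c → (a :+ c) :+ c := a) refl

switch-same-side : ∀ (G : Graph n) A {u v} → A u ≡ A v → adj (switch G A) u v ≡ adj G u v
switch-same-side G A {u} {v} Au≡Av with A u | A v | Au≡Av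
... | true  | .true  | refl = refl
... | false | .false | refl = refl

switch-across : ∀ (G : Graph n) A {u v} → A u ≡ false → A v ≡ true →
                adj (switch G A) u v ≡ not (adj G u v)
switch-across G A {u} {v} Au Av rewrite Au | Av = refl

switch-⊕ : ∀ (G : Graph n) A B → switch (switch G A) B ≈ switch G (A ⊕ B)
switch-⊕ G A B u v = begin
  adj (switch (switch G A) B) u v                  ≡⟨ adj-switch (switch G A) B u v ⟩
  adj (switch G A) u v xor (B u xor B v)           ≡⟨ cong (_xor (B u xor B v)) (adj-switch G A u v) ⟩
  (adj G u v xor (A u xor A v)) xor (B u xor B v)  ≡⟨ regroup (adj G u v) (A u) (A v) (B u) (B v) ⟩
  adj G u v xor ((A ⊕ B) u xor (A ⊕ B) v)          ≡⟨ adj-switch G (A ⊕ B) u v ⟨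
  adj (switch G (A ⊕ B)) u v                       ∎
  where
  open ≡-Reasoning
  regroup : ∀ g a b c d → (g xor (a xor b)) xor (c xor d) ≡ g xor ((a xor c) xor (b xor d))
  regroup = solve 5 (λ g a b c d → (g :+ (a :+ b)) :+ (c :+ d) := g :+ ((a :+ c) :+ (b :+ d))) refl

isolate : Graph n → Fin n → Graph n
isolate G v = switch G (adj G v)

isolate-isolates : ∀ (G : Graph n) v z → isolate G v ⊢ v ≁ z
isolate-isolates G v z = begin
  adj (isolate G v) v z                         ≡⟨ adj-switch G (adj G v) v z ⟩
  adj G v z xor (adj G v v xor adj G v z)       ≡⟨ cong (λ b → adj G v z xor (b xor adj G v z)) (irrfl G v) ⟩
  adj G v z xor adj G v z                       ≡⟨ xor-same (adj G v z) ⟩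
  false                                         ∎
  where open ≡-Reasoning

isolate-switch : ∀ (G : Graph n) A v → isolate (switch G A) v ≈ isolate G v
isolate-switch G A v x y = begin
  adj (isolate (switch G A) v) x y
    ≡⟨ adj-switch (switch G A) (adj (switch G A) v) x y ⟩
  adj (switch G A) x y xor (adj (switch G A) v x xor adj (switch G A) v y)
    ≡⟨ cong₂ _xor_ (adj-switch G A x y) (cong₂ _xor_ (adj-switch G A v x) (adj-switch G A v y)) ⟩
  (adj G x y xor (A x xor A y)) xor ((adj G v x xor (A v xor A x)) xor (adj G v y xor (A v xor A y)))
    ≡⟨ cancel (adj G x y) (A x) (A y) (A v) (adj G v x) (adj G v y) ⟩
  adj G x y xor (adj G v x xor adj G v y)
    ≡⟨ adj-switch G (adj G v) x y ⟨
  adj (isolate G v) x y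
    ∎
  where
  open ≡-Reasoning
  cancel : ∀ g a b c p q →
           (g xor (a xor b)) xor ((p xor (c xor a)) xor (q xor (c xor b))) ≡ g xor (p xor q)
  cancel = solve 6 (λ g a b c p q →
    (g :+ (a :+ b)) :+ ((p :+ (c :+ a)) :+ (q :+ (c :+ b))) := g :+ (p :+ q)) refl

InducedCopy-resp-≈ : ∀ (G H : Graph n) {h : Fin m → Fin m → Bool} →
                     G ≈ H → InducedCopy h G → InducedCopy h H
InducedCopy-resp-≈ G H G≈H (f , f-injective , realised) =
  f , f-injective , λ i j → trans (sym (G≈H (f i) (f j))) (realised i j)

C5coC6Free-resp-≈ : ∀ (G H : Graph n) → G ≈ H → C5coC6Free H → C5coC6Free G
C5coC6Free-resp-≈ G H G≈H (noC5 , noC6) =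
  (λ copy → noC5 (InducedCopy-resp-≈ G H G≈H copy)) , (λ copy → noC6 (InducedCopy-resp-≈ G H G≈H copy))

LowerSwitching-switch : ∀ (G : Graph n) A →
                        LowerSwitching C5coC6Free G → LowerSwitching C5coC6Free (switch G A)
LowerSwitching-switch G A free B =
  C5coC6Free-resp-≈ (switch (switch G A) B) (switch G (A ⊕ B)) (switch-⊕ G A B) (free (A ⊕ B))

Pattern : ℕ → Set
Pattern m = Fin m → Fin m → Bool

Realises : Graph n → (Fin m → Fin n) → Pattern m → Set
Realises G f g = ∀ i j → adj G (f i) (f j) ≡ g i j

switchPattern : Pattern m → (Fin m → Bool) → Pattern m
switchPattern g x i j = g i j xor (x i xor x j)

realises-switch : ∀ {G : Graph n} {f : Fin m → Fin n} {g x} X →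
                  Realises G f g → (∀ i → X (f i) ≡ x i) → Realises (switch G X) f (switchPattern g x)
realises-switch {G = G} {f} X realised X∘f≗x i j =
  trans (adj-switch G X (f i) (f j)) (cong₂ _xor_ (realised i j) (cong₂ _xor_ (X∘f≗x i) (X∘f≗x j)))

switchPattern-involutive : ∀ (g : Pattern m) x i j → switchPattern (switchPattern g x) x i j ≡ g i j
switchPattern-involutive g x i j = xor-cancelʳ (g i j) (x i xor x j)

TwinFree : Pattern m → Set
TwinFree {m} g = ∀ i j → i ≢ j → g i j ≡ true ⊎ ∃ λ k → g i k ≢ g j k

realises-injective : ∀ {G : Graph n} {f : Fin m → Fin n} {g} →
                     TwinFree g → Realises G f g → Injective _≡_ _≡_ f
realises-injective {G = G} {f} {g} twinFree realised {i} {j} fi≡fj with i ≟ j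
... | yes i≡j = i≡j
... | no i≢j with twinFree i j i≢j
...   | inj₁ gij = ⊥-elim (~⇒≢ G (trans (realised i j) gij) fi≡fj)
...   | inj₂ (k , gik≢gjk) =
  ⊥-elim (gik≢gjk (trans (sym (realised i k)) (trans (cong (λ z → adj G z (f k)) fi≡fj) (realised j k))))

upperPairs : ∀ m → List (Fin m × Fin m)
upperPairs zero    = []
upperPairs (suc m) = map (λ j → zero , suc j) (allFin m) ++ map (Product.map suc suc) (upperPairs m)

∈-upperPairs : ∀ {i j : Fin m} → i < j → (i , j) ∈ upperPairs m
∈-upperPairs {suc m} {zero}  {suc j} _         = ∈-++⁺ˡ (∈-map⁺ (λ j → zero , suc j) (∈-allFin j))
∈-upperPairs {suc m} {suc i} {suc j} (s≤s i<j) =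
  ∈-++⁺ʳ _ (∈-map⁺ (Product.map suc suc) (∈-upperPairs i<j))

Simple : Pattern m → Set
Simple {m} g = (∀ i → g i i ≡ false) × (∀ i j → g i j ≡ g j i)

simple? : (g : Pattern m) → Dec (Simple g)
simple? g = all? (λ i → g i i ≟ᵇ false) ×-dec all? (λ i → all? λ j → g i j ≟ᵇ g j i)

twinFree? : (g : Pattern m) → Dec (TwinFree g)
twinFree? g = all? λ i → all? λ j →
  ¬? (i ≟ j) →-dec (g i j ≟ᵇ true ⊎-dec any? λ k → ¬? (g i k ≟ᵇ g j k))

switchPattern-simple : ∀ {g : Pattern m} x → Simple g → Simple (switchPattern g x)
switchPattern-simple {g = g} x (loopless , symmetric) =
  (λ i → trans (cong (g i i xor_) (xor-same (x i))) (trans (xor-identityʳ (g i i)) (loopless i))) ,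
  (λ i j → cong₂ _xor_ (symmetric i j) (xor-comm (x i) (x j)))

realises-upper : ∀ (G : Graph n) {f : Fin m → Fin n} {g} → Simple g →
                 All (uncurry λ i j → adj G (f i) (f j) ≡ g i j) (upperPairs m) → Realises G f g
realises-upper G {f} (g-loopless , g-sym) upper i j with <-cmp i j
... | tri< i<j _ _ = All.lookup upper (∈-upperPairs i<j)
... | tri≈ _ refl _ = trans (irrfl G (f i)) (sym (g-loopless i))
... | tri> _ _ j<i =
  trans (Graph.sym G (f i) (f j)) (trans (All.lookup upper (∈-upperPairs j<i)) (g-sym j i))

switched-copy : ∀ (G : Graph n) {f : Fin m → Fin n} {t x} X → TwinFree t →
                Realises G f (switchPattern t x) → (∀ i → X (f i) ≡ x i) → InducedCopy t (switch G X)
switched-copy G {f} {t} {x} X twinFree realised X∘f≗x =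
  f , realises-injective {G = switch G X} twinFree realisesT , realisesT
  where
  realisesT : Realises (switch G X) f t
  realisesT i j = trans (realises-switch {G = G} X realised X∘f≗x i j) (switchPattern-involutive t x i j)

-- Opaque, so that goals about `vertexSet vs (f i)` are not unfolded during unification.
opaque
  vertexSet : List (Fin n) → VSet n
  vertexSet vs z = does (Any.any? (z ≟_) vs)

  ∈⇒vertexSet : ∀ {z : Fin n} {vs} → z ∈ vs → vertexSet vs z ≡ true
  ∈⇒vertexSet {z = z} {vs} = dec-true (Any.any? (z ≟_) vs)

  ∉⇒vertexSet : ∀ {z : Fin n} {vs} → All (z ≢_) vs → vertexSet vs z ≡ false
  ∉⇒vertexSet {z = z} {vs} z∉vs = dec-false (Any.any? (z ≟_) vs) (All¬⇒¬Any z∉vs)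

C5-simple : Simple C5adj
C5-simple = from-yes (simple? C5adj)

C5-twinFree : TwinFree C5adj
C5-twinFree = from-yes (twinFree? C5adj)

coC6-simple : Simple coC6adj
coC6-simple = from-yes (simple? coC6adj)

coC6-twinFree : TwinFree coC6adj
coC6-twinFree = from-yes (twinFree? coC6adj)

-- Comparability graphs have no induced C₅ or prism

module _ (G : Graph n) where

  reverse : TransitiveOrientation G → TransitiveOrientation G
  reverse O = record
    { arc      = λ u v → arc v u
    ; arc⇒edge = λ u v vu → ~-sym G (arc⇒edge v u vu)
    ; edge⇒arc = λ u v uv → Sum.swap (edge⇒arc u v uv)
    ; antisym  = λ u v vu → antisym v u vu
    ; trans    = λ x y z yx zy → arc-trans z y x zy yx
    }
    where open TransitiveOrientation O renaming (trans to arc-trans)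

  module _ (O : TransitiveOrientation G) where
    open TransitiveOrientation O renaming (trans to arc-trans)

    P₃-sink : ∀ {a b c} → G ⊢ a ~ b → G ⊢ b ~ c → G ⊢ a ≁ c → arc a b ≡ true → arc c b ≡ true
    P₃-sink {a} {b} {c} ab bc ac a→b with edge⇒arc b c bc
    ... | inj₂ c→b = c→b
    ... | inj₁ b→c = ⊥-elim (~-≁-contradiction G (arc⇒edge a c (arc-trans a b c a→b b→c)) ac)

    P₃-source : ∀ {a b c} → G ⊢ a ~ b → G ⊢ b ~ c → G ⊢ a ≁ c → arc b a ≡ true → arc b c ≡ true
    P₃-source {a} {b} {c} ab bc ac b→a with edge⇒arc b c bc
    ... | inj₁ b→c = b→c
    ... | inj₂ c→b = ⊥-elim (~-≁-contradiction G (arc⇒edge c a (arc-trans c b a c→b b→a)) (≁-sym G ac))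

    arc-asym : ∀ {u v} → arc u v ≡ true → arc v u ≡ true → ⊥
    arc-asym {u} {v} u→v v→u with trans (sym v→u) (antisym u v u→v)
    ... | ()

    C5-unorientable : ∀ {f : Fin 5 → Fin n} → Realises G f C5adj → arc (f 0F) (f 1F) ≡ true → ⊥
    C5-unorientable {f} P a01 = arc-asym a01 a10
      where
      a21 : arc (f 2F) (f 1F) ≡ true
      a21 = P₃-sink   (P 0F 1F) (P 1F 2F) (P 0F 2F) a01
      a23 : arc (f 2F) (f 3F) ≡ true
      a23 = P₃-source (P 1F 2F) (P 2F 3F) (P 1F 3F) a21
      a43 : arc (f 4F) (f 3F) ≡ true
      a43 = P₃-sink   (P 2F 3F) (P 3F 4F) (P 2F 4F) a23
      a40 : arc (f 4F) (f 0F) ≡ true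
      a40 = P₃-source (P 3F 4F) (P 4F 0F) (P 3F 0F) a43
      a10 : arc (f 1F) (f 0F) ≡ true
      a10 = P₃-sink   (P 4F 0F) (P 0F 1F) (P 4F 1F) a40

    coC6-unorientable : ∀ {f : Fin 6 → Fin n} → Realises G f coC6adj → arc (f 0F) (f 2F) ≡ true → ⊥
    coC6-unorientable {f} P a02 = arc-asym a14 a41
      where
      a03 : arc (f 0F) (f 3F) ≡ true
      a03 = P₃-source (P 2F 0F) (P 0F 3F) (P 2F 3F) a02
      a04 : arc (f 0F) (f 4F) ≡ true
      a04 = P₃-source (P 3F 0F) (P 0F 4F) (P 3F 4F) a03
      a52 : arc (f 5F) (f 2F) ≡ true
      a52 = P₃-sink   (P 0F 2F) (P 2F 5F) (P 0F 5F) a02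
      a42 : arc (f 4F) (f 2F) ≡ true
      a42 = P₃-sink   (P 5F 2F) (P 2F 4F) (P 5F 4F) a52
      a14 : arc (f 1F) (f 4F) ≡ true
      a14 = P₃-sink   (P 0F 4F) (P 4F 1F) (P 0F 1F) a04
      a41 : arc (f 4F) (f 1F) ≡ true
      a41 = P₃-source (P 2F 4F) (P 4F 1F) (P 2F 1F) a42

  comparability⇒C5coC6Free : Comparability G → C5coC6Free G
  comparability⇒C5coC6Free O =
    (λ (f , _ , P) → [ C5-unorientable O P , C5-unorientable (reverse O) P ]
                       (edge⇒arc (f 0F) (f 1F) (P 0F 1F))) ,
    (λ (f , _ , P) → [ coC6-unorientable O P , coC6-unorientable (reverse O) P ]
                       (edge⇒arc (f 0F) (f 2F) (P 0F 2F)))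
    where open TransitiveOrientation O

Isolated : Graph n → Fin n → Set
Isolated H t = ∀ z → H ⊢ t ≁ z

record InducedP4 (H : Graph n) (a b c d : Fin n) : Set where
  constructor induced-P4
  field
    ab : H ⊢ a ~ b
    bc : H ⊢ b ~ c
    cd : H ⊢ c ~ d
    ac : H ⊢ a ≁ c
    ad : H ⊢ a ≁ d
    bd : H ⊢ b ≁ d

record InducedC4 (H : Graph n) (p q r s : Fin n) : Set where
  constructor induced-C4
  field
    pq  : H ⊢ p ~ q
    qr  : H ⊢ q ~ r
    rs  : H ⊢ r ~ s
    sp  : H ⊢ s ~ p
    pr  : H ⊢ p ≁ r
    qs  : H ⊢ q ≁ s
    p≢r : p ≢ r
    q≢s : q ≢ s

P4Free C4Free : Graph n → Set
P4Free H = ∀ {a b c d} → ¬ InducedP4 H a b c d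
C4Free H = ∀ {p q r s} → ¬ InducedC4 H p q r s

isolated-≢ : ∀ (H : Graph n) {t u v} → Isolated H t → H ⊢ u ~ v → t ≢ u
isolated-≢ H {t} {u} {v} t-isolated uv refl = ~-≁-contradiction H uv (t-isolated v)

prismTriangle : Fin 6 → Bool
prismTriangle i = toℕ i % 2 ≡ᵇ 1

module _ (H : Graph n) (free : LowerSwitching C5coC6Free H) where

  -- Switching the prism at its triangle {1, 3, 5} leaves K₂,₂,₂ with antipodal pairs {0, 3}, {1, 4}, {2, 5}.
  K222-free : ∀ {p q r s w y} → InducedC4 H p q r s →
              All (H ⊢ w ~_) (p ∷ q ∷ r ∷ s ∷ []) → All (H ⊢ y ~_) (p ∷ q ∷ r ∷ s ∷ []) →
              H ⊢ w ≁ y → w ≢ y → ⊥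
  K222-free {p = p} {q} {r} {s} {w} {y} (induced-C4 pq qr rs sp pr qs p≢r q≢s)
            (wp ∷ wq ∷ wr ∷ ws ∷ []) (yp ∷ yq ∷ yr ∷ ys ∷ []) wy w≢y =
    proj₂ (free X) (switched-copy H X coC6-twinFree realised X∘f≗x)
    where
    f : Fin 6 → Fin n
    f 0F = p
    f 1F = q
    f 2F = y
    f 3F = r
    f 4F = s
    f 5F = w
    X : VSet n
    X = vertexSet (r ∷ q ∷ w ∷ [])
    realised : Realises H f (switchPattern coC6adj prismTriangle)
    realised = realises-upper H (switchPattern-simple prismTriangle coC6-simple)
      (pq ∷ ~-sym H yp ∷ pr ∷ ~-sym H sp ∷ ~-sym H wp ∷ ~-sym H yq ∷ qr ∷ qs ∷ ~-sym H wq ∷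
       yr ∷ ys ∷ ≁-sym H wy ∷ rs ∷ ~-sym H wr ∷ ~-sym H ws ∷ [])
    X∘f≗x : ∀ i → X (f i) ≡ prismTriangle i
    X∘f≗x 0F = ∉⇒vertexSet (p≢r ∷ ~⇒≢ H pq ∷ ~⇒≢ H (~-sym H wp) ∷ [])
    X∘f≗x 1F = ∈⇒vertexSet (there (here refl))
    X∘f≗x 2F = ∉⇒vertexSet (~⇒≢ H yr ∷ ~⇒≢ H yq ∷ ≢-sym w≢y ∷ [])
    X∘f≗x 3F = ∈⇒vertexSet (here refl)
    X∘f≗x 4F = ∉⇒vertexSet (~⇒≢ H (~-sym H rs) ∷ ≢-sym q≢s ∷ ~⇒≢ H (~-sym H ws) ∷ [])
    X∘f≗x 5F = ∈⇒vertexSet (there (there (here refl)))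

  module _ {t : Fin n} (t-isolated : Isolated H t) where

    -- Switching C₅ at N(0) = {1, 4} isolates 0 and leaves the path 1 – 3 – 2 – 4.
    isolated⇒P4-free : P4Free H
    isolated⇒P4-free {a} {b} {c} {d} (induced-P4 ab bc cd ac ad bd) =
      proj₁ (free X) (switched-copy H X C5-twinFree realised X∘f≗x)
      where
      f : Fin 5 → Fin n
      f 0F = t
      f 1F = a
      f 2F = c
      f 3F = b
      f 4F = d
      X : VSet n
      X = vertexSet (a ∷ d ∷ [])
      realised : Realises H f (switchPattern C5adj (C5adj 0F))
      realised = realises-upper H (switchPattern-simple (C5adj 0F) C5-simple)
        (t-isolated a ∷ t-isolated c ∷ t-isolated b ∷ t-isolated d ∷
         ac ∷ ab ∷ ad ∷ ~-sym H bc ∷ cd ∷ bd ∷ [])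
      X∘f≗x : ∀ i → X (f i) ≡ C5adj 0F i
      X∘f≗x 0F = ∉⇒vertexSet (isolated-≢ H t-isolated ab ∷ isolated-≢ H t-isolated (~-sym H cd) ∷ [])
      X∘f≗x 1F = ∈⇒vertexSet (here refl)
      X∘f≗x 2F = ∉⇒vertexSet (~≁⇒≢ H (~-sym H cd) (≁-sym H ad) ∷ ~⇒≢ H cd ∷ [])
      X∘f≗x 3F = ∉⇒vertexSet (~⇒≢ H (~-sym H ab) ∷ ~≁⇒≢ H ab ad ∷ [])
      X∘f≗x 4F = ∈⇒vertexSet (there (here refl))

    -- Switching the prism at N(0) = {2, 3, 4} isolates 0 and 3 and leaves the 4-cycle 1 – 2 – 4 – 5.
    isolated⇒C4+K1-free : ∀ {p q r s e} → InducedC4 H p q r s → All (H ⊢ e ≁_) (p ∷ q ∷ r ∷ s ∷ []) →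
                          e ≢ t → ⊥
    isolated⇒C4+K1-free {p} {q} {r} {s} {e} (induced-C4 pq qr rs sp pr qs p≢r q≢s)
                        (ep ∷ eq ∷ er ∷ es ∷ []) e≢t =
      proj₂ (free X) (switched-copy H X coC6-twinFree realised X∘f≗x)
      where
      f : Fin 6 → Fin n
      f 0F = t
      f 1F = r
      f 2F = q
      f 3F = e
      f 4F = p
      f 5F = s
      X : VSet n
      X = vertexSet (e ∷ p ∷ q ∷ [])
      realised : Realises H f (switchPattern coC6adj (coC6adj 0F))
      realised = realises-upper H (switchPattern-simple (coC6adj 0F) coC6-simple)
        (t-isolated r ∷ t-isolated q ∷ t-isolated e ∷ t-isolated p ∷ t-isolated s ∷
         ~-sym H qr ∷ ≁-sym H er ∷ ≁-sym H pr ∷ rs ∷ ≁-sym H eq ∷ ~-sym H pq ∷ qs ∷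
         ep ∷ es ∷ ~-sym H sp ∷ [])
      X∘f≗x : ∀ i → X (f i) ≡ coC6adj 0F i
      X∘f≗x 0F = ∉⇒vertexSet (≢-sym e≢t ∷ isolated-≢ H t-isolated pq ∷ isolated-≢ H t-isolated qr ∷ [])
      X∘f≗x 1F = ∉⇒vertexSet (~≁⇒≢ H qr (≁-sym H eq) ∷ ≢-sym p≢r ∷ ~⇒≢ H (~-sym H qr) ∷ [])
      X∘f≗x 2F = ∈⇒vertexSet (there (there (here refl)))
      X∘f≗x 3F = ∈⇒vertexSet (here refl)
      X∘f≗x 4F = ∈⇒vertexSet (there (here refl))
      X∘f≗x 5F = ∉⇒vertexSet (~≁⇒≢ H (~-sym H sp) (≁-sym H ep) ∷ ~⇒≢ H sp ∷ ≢-sym q≢s ∷ [])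

-- Closed neighbourhoods and {P₄, C₄}-free graphs

from-does : ∀ {A : Set} (a? : Dec A) → does a? ≡ true → A
from-does (yes a) _ = a

module Neighbourhood (K : Graph n) where

  infix 4 _∈N[_] _⊆N_

  _∈N[_] : Fin n → Fin n → Set
  z ∈N[ x ] = x ≡ z ⊎ K ⊢ x ~ z

  _∈N?_ : ∀ z x → Dec (z ∈N[ x ])
  z ∈N? x = x ≟ z ⊎-dec adj K x z ≟ᵇ true

  ∉N⇒≢ : ∀ {z x} → ¬ z ∈N[ x ] → x ≢ z
  ∉N⇒≢ z∉Nx x≡z = z∉Nx (inj₁ x≡z)

  ∉N⇒≁ : ∀ {z x} → ¬ z ∈N[ x ] → K ⊢ x ≁ z
  ∉N⇒≁ z∉Nx = ¬-not (z∉Nx ∘ inj₂)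

  ∈N⇒~ : ∀ {z x} → z ∈N[ x ] → x ≢ z → K ⊢ x ~ z
  ∈N⇒~ (inj₁ x≡z) x≢z = ⊥-elim (x≢z x≡z)
  ∈N⇒~ (inj₂ xz)  _   = xz

  _⊆N_ : Fin n → Fin n → Set
  x ⊆N y = ∀ z → z ∈N[ x ] → z ∈N[ y ]

  _⊆N?_ : ∀ x y → Dec (x ⊆N y)
  x ⊆N? y = all? λ z → z ∈N? x →-dec z ∈N? y

  ⊆N-refl : ∀ {x} → x ⊆N x
  ⊆N-refl _ z∈Nx = z∈Nx

  ⊆N-trans : ∀ {x y z} → x ⊆N y → y ⊆N z → x ⊆N z
  ⊆N-trans x⊆y y⊆z v = y⊆z v ∘ x⊆y v

  ⊈N⇒∃ : ∀ {x y} → ¬ x ⊆N y → ∃ λ z → z ∈N[ x ] × ¬ z ∈N[ y ]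
  ⊈N⇒∃ {x} {y} x⊈y with ¬∀⟶∃¬ n _ (λ z → z ∈N? x →-dec z ∈N? y) x⊈y
  ... | z , z∉ with z ∈N? x
  ...   | yes z∈Nx = z , z∈Nx , λ z∈Ny → z∉ (λ _ → z∈Ny)
  ...   | no  z∉Nx = ⊥-elim (z∉ (⊥-elim ∘ z∉Nx))

  MinimalExcept : Fin n → Fin n → Set
  MinimalExcept v₀ w = ∀ x → x ≢ v₀ → x ⊆N w → w ⊆N x

  -- Opaque, as unfolding the tabulation during conversion checking is very expensive.
  opaque
    N[_] : Fin n → Subset n
    N[ x ] = tabulate λ z → does (z ∈N? x)

    ∈N[]⁺ : ∀ {z x} → z ∈N[ x ] → z ∈ₛ N[ x ]
    ∈N[]⁺ {z} {x} z∈Nx = lookup⇒[]= z N[ x ] (trans (lookup∘tabulate _ z) (dec-true (z ∈N? x) z∈Nx))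

    ∈N[]⁻ : ∀ {z x} → z ∈ₛ N[ x ] → z ∈N[ x ]
    ∈N[]⁻ {z} {x} z∈Nx = from-does (z ∈N? x) (trans (sym (lookup∘tabulate _ z)) ([]=⇒lookup z∈Nx))

  ⊆N-∣N∣-< : ∀ {x y z} → x ⊆N y → z ∈N[ y ] → ¬ z ∈N[ x ] → ∣ N[ x ] ∣ <ℕ ∣ N[ y ] ∣
  ⊆N-∣N∣-< x⊆y z∈Ny z∉Nx =
    p⊂q⇒∣p∣<∣q∣ ((λ v∈Nx → ∈N[]⁺ (x⊆y _ (∈N[]⁻ v∈Nx))) , _ , ∈N[]⁺ z∈Ny , z∉Nx ∘ ∈N[]⁻)

module TriviallyPerfect (K : Graph n) (P4-free : P4Free K) (C4-free : C4Free K) where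
  open Neighbourhood K

  induced-path₄-impossible : ∀ {a x y b} → K ⊢ a ~ x → K ⊢ x ~ y → K ⊢ y ~ b → K ⊢ a ≁ y → K ⊢ x ≁ b →
                             a ≢ y → x ≢ b → ⊥
  induced-path₄-impossible {a} {b = b} ax xy yb ay xb a≢y x≢b with adj K a b in ab
  ... | true  = C4-free (induced-C4 ax xy yb (~-sym K ab) ay xb a≢y x≢b)
  ... | false = P4-free (induced-P4 ax xy yb ay ab xb)

  adjacent-comparable : ∀ {x y} → K ⊢ x ~ y → x ⊆N y ⊎ y ⊆N x
  adjacent-comparable {x} {y} xy with x ⊆N? y | y ⊆N? x
  ... | yes x⊆y | _       = inj₁ x⊆y
  ... | no _    | yes y⊆x = inj₂ y⊆x
  ... | no x⊈y  | no y⊈x  with ⊈N⇒∃ x⊈y | ⊈N⇒∃ y⊈x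
  ...   | a , a∈Nx , a∉Ny | b , b∈Ny , b∉Nx =
    ⊥-elim (induced-path₄-impossible ax xy yb (≁-sym K (∉N⇒≁ a∉Ny)) (∉N⇒≁ b∉Nx)
                                     (≢-sym (∉N⇒≢ a∉Ny)) (∉N⇒≢ b∉Nx))
    where
    ax : K ⊢ a ~ x
    ax = ~-sym K (∈N⇒~ a∈Nx λ x≡a → a∉Ny (inj₂ (subst (K ⊢ y ~_) x≡a (~-sym K xy))))
    yb : K ⊢ y ~ b
    yb = ∈N⇒~ b∈Ny λ y≡b → b∉Nx (inj₂ (subst (K ⊢ x ~_) y≡b xy))

  infix 4 _≺_
  _≺_ : Fin n → Fin n → Set
  x ≺ y = K ⊢ x ~ y × x ⊆N y × (y ⊆N x → x < y)

  _≺?_ : ∀ x y → Dec (x ≺ y)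
  x ≺? y = adj K x y ≟ᵇ true ×-dec x ⊆N? y ×-dec (y ⊆N? x →-dec x <? y)

  ≺-asym : ∀ {x y} → x ≺ y → y ≺ x → ⊥
  ≺-asym (_ , x⊆y , x<y) (_ , y⊆x , y<x) = <-asym (x<y y⊆x) (y<x x⊆y)

  ≺-trans : ∀ {x y z} → x ≺ y → y ≺ z → x ≺ z
  ≺-trans {x} {y} {z} (_ , x⊆y , x<y) (_ , y⊆z , y<z) = xz , x⊆z , x<z
    where
    x⊆z : x ⊆N z
    x⊆z = ⊆N-trans x⊆y y⊆z
    x<z : z ⊆N x → x < z
    x<z z⊆x = <-trans (x<y (⊆N-trans y⊆z z⊆x)) (y<z (⊆N-trans z⊆x x⊆y))
    xz : K ⊢ x ~ z
    xz = ~-sym K (∈N⇒~ (x⊆z x (inj₁ refl)) λ { refl → <-irrefl refl (x<z ⊆N-refl) })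

  ≺-connex-⊆ : ∀ {x y} → K ⊢ x ~ y → x ⊆N y → x ≺ y ⊎ y ≺ x
  ≺-connex-⊆ {x} {y} xy x⊆y with y ⊆N? x
  ... | no y⊈x = inj₁ (xy , x⊆y , ⊥-elim ∘ y⊈x)
  ... | yes y⊆x with <-cmp x y
  ...   | tri< x<y _ _ = inj₁ (xy , x⊆y , const x<y)
  ...   | tri≈ _ x≡y _ = ⊥-elim (~⇒≢ K xy x≡y)
  ...   | tri> _ _ y<x = inj₂ (~-sym K xy , y⊆x , const y<x)

  ≺-connex : ∀ {x y} → K ⊢ x ~ y → x ≺ y ⊎ y ≺ x
  ≺-connex xy with adjacent-comparable xy
  ... | inj₁ x⊆y = ≺-connex-⊆ xy x⊆y
  ... | inj₂ y⊆x = Sum.swap (≺-connex-⊆ (~-sym K xy) y⊆x)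

  ≺-orientation : TransitiveOrientation K
  ≺-orientation = record
    { arc      = λ x y → does (x ≺? y)
    ; arc⇒edge = λ x y x≺y → proj₁ (from-does (x ≺? y) x≺y)
    ; edge⇒arc = λ x y xy → Sum.map (dec-true (x ≺? y)) (dec-true (y ≺? x)) (≺-connex xy)
    ; antisym  = λ x y x≺y → dec-false (y ≺? x) (≺-asym (from-does (x ≺? y) x≺y))
    ; trans    = λ x y z x≺y y≺z →
                   dec-true (x ≺? z) (≺-trans (from-does (x ≺? y) x≺y) (from-does (y ≺? z) y≺z))
    }

  ≺-orientation-⊆N : ∀ {x y} → TransitiveOrientation.arc ≺-orientation x y ≡ true → x ⊆N y
  ≺-orientation-⊆N {x} {y} x≺y = proj₁ (proj₂ (from-does (x ≺? y) x≺y))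

-- Orienting G from the graph in which w is isolated

module Lift (G : Graph n) (w : Fin n) (O : TransitiveOrientation (isolate G w))
            (O-⊆N : ∀ {x y} → TransitiveOrientation.arc O x y ≡ true → Neighbourhood._⊆N_ (isolate G w) x y)
            where

  private
    K : Graph n
    K = isolate G w
  open TransitiveOrientation O renaming (arc to arcK; arc⇒edge to arcK⇒edge; edge⇒arc to edge⇒arcK;
                                         antisym to arcK-antisym; trans to arcK-trans)
  open Neighbourhood K

  data Part : Set where
    centre nbr nonNbr : Part

  part : Fin n → Part
  part x with x ≟ w
  ... | yes _ = centre
  ... | no  _ = if adj G w x then nbr else nonNbr

  data PartView (x : Fin n) : Part → Set where
    is-centre : x ≡ w → PartView x centre
    is-nbr    : G ⊢ w ~ x → PartView x nbr
    is-nonNbr : G ⊢ w ≁ x → PartView x nonNbr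

  partView : ∀ x → PartView x (part x)
  partView x with x ≟ w
  ... | yes x≡w = is-centre x≡w
  ... | no  _ with adj G w x in wx
  ...   | true  = is-nbr wx
  ...   | false = is-nonNbr wx

  -- K agrees with G on each side of N(w): the orientation of K is kept outside N(w) and reversed
  -- inside it, and every other edge of G points into N(w).
  orient : Part → Part → Fin n → Fin n → Bool
  orient _      centre _ _ = false
  orient centre _      x y = adj G x y
  orient nonNbr nbr    x y = adj G x y
  orient nbr    nonNbr _ _ = false
  orient nonNbr nonNbr x y = arcK x y
  orient nbr    nbr    x y = arcK y x

  K-same-side : ∀ {x y b} → adj G w x ≡ b → adj G w y ≡ b → adj K x y ≡ adj G x y
  K-same-side wx wy = switch-same-side G (adj G w) (trans wx (sym wy))

  lifted-arc⇒edge : ∀ x y → orient (part x) (part y) x y ≡ true → G ⊢ x ~ y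
  lifted-arc⇒edge x y xy with part x | partView x | part y | partView y
  ... | centre | _            | nbr    | _            = xy
  ... | centre | _            | nonNbr | _            = xy
  ... | nonNbr | _            | nbr    | _            = xy
  ... | nonNbr | is-nonNbr wx | nonNbr | is-nonNbr wy = trans (sym (K-same-side wx wy)) (arcK⇒edge x y xy)
  ... | nbr    | is-nbr wx    | nbr    | is-nbr wy    =
    trans (sym (K-same-side wx wy)) (~-sym K (arcK⇒edge y x xy))

  lifted-edge⇒arc : ∀ x y → G ⊢ x ~ y →
                    orient (part x) (part y) x y ≡ true ⊎ orient (part y) (part x) y x ≡ true
  lifted-edge⇒arc x y xy with part x | partView x | part y | partView y
  ... | centre | is-centre refl | centre | is-centre y≡w = ⊥-elim (~⇒≢ G xy (sym y≡w))
  ... | centre | _            | nbr    | _            = inj₁ xy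
  ... | centre | _            | nonNbr | _            = inj₁ xy
  ... | nbr    | _            | centre | _            = inj₂ (~-sym G xy)
  ... | nonNbr | _            | centre | _            = inj₂ (~-sym G xy)
  ... | nonNbr | _            | nbr    | _            = inj₁ xy
  ... | nbr    | _            | nonNbr | _            = inj₂ (~-sym G xy)
  ... | nonNbr | is-nonNbr wx | nonNbr | is-nonNbr wy = edge⇒arcK x y (trans (K-same-side wx wy) xy)
  ... | nbr    | is-nbr wx    | nbr    | is-nbr wy    =
    Sum.swap (edge⇒arcK x y (trans (K-same-side wx wy) xy))

  lifted-antisym : ∀ x y → orient (part x) (part y) x y ≡ true → orient (part y) (part x) y x ≡ false
  lifted-antisym x y xy with part x | part y
  ... | centre | nbr    = refl
  ... | centre | nonNbr = refl
  ... | nonNbr | nbr    = refl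
  ... | nonNbr | nonNbr = arcK-antisym x y xy
  ... | nbr    | nbr    = arcK-antisym y x xy

  K-across : ∀ {x y} → G ⊢ w ≁ x → G ⊢ w ~ y → G ⊢ x ~ y → K ⊢ x ≁ y
  K-across wx wy xy = trans (switch-across G (adj G w) wx wy) (cong not xy)

  nonNbr-nbr-edge : ∀ {x z} → G ⊢ w ≁ x → G ⊢ w ~ z → ¬ K ⊢ x ~ z → G ⊢ x ~ z
  nonNbr-nbr-edge wx wz ¬xz = not-injective (trans (sym (switch-across G (adj G w) wx wz)) (¬-not ¬xz))

  lifted-trans : ∀ x y z → orient (part x) (part y) x y ≡ true → orient (part y) (part z) y z ≡ true →
                 orient (part x) (part z) x z ≡ true
  lifted-trans x y z xy yz with part x | partView x | part y | partView y | part z | partView z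
  ... | centre | is-centre refl | nbr    | _            | nbr    | is-nbr wz    = wz
  ... | centre | is-centre refl | nonNbr | is-nonNbr wy | _      | _            =
    ⊥-elim (~-≁-contradiction G xy wy)
  ... | nonNbr | is-nonNbr wx   | nbr    | is-nbr wy    | nbr    | is-nbr wz    =
    nonNbr-nbr-edge wx wz λ xz →
      [ ~≁⇒≢ G wy wx , (λ yx → ~-≁-contradiction K (~-sym K yx) (K-across wx wy xy)) ]
        (O-⊆N yz x (inj₂ (~-sym K xz)))
  ... | nonNbr | is-nonNbr wx   | nonNbr | is-nonNbr wy | nbr    | is-nbr wz    =
    nonNbr-nbr-edge wx wz λ xz →
      [ ≢-sym (~≁⇒≢ G wz wy) , (λ yz′ → ~-≁-contradiction K yz′ (K-across wy wz yz)) ]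
        (O-⊆N xy z (inj₂ xz))
  ... | nonNbr | _              | nonNbr | _            | nonNbr | _            = arcK-trans x y z xy yz
  ... | nbr    | _              | nbr    | _            | nbr    | _            = arcK-trans z y x yz xy

  lifted-orientation : TransitiveOrientation G
  lifted-orientation = record
    { arc      = λ x y → orient (part x) (part y) x y
    ; arc⇒edge = lifted-arc⇒edge
    ; edge⇒arc = lifted-edge⇒arc
    ; antisym  = lifted-antisym
    ; trans    = lifted-trans
    }

-- A vertex with minimal closed neighbourhood

∃-minimiser : ∀ {k} (c : Fin (suc k) → ℕ) → ∃ λ i → ∀ j → c i ≤ℕ c j
∃-minimiser {k} c = i , λ j → All.lookup (f[argmin]≤f[xs] {f = c} zero (allFin (suc k))) (∈-allFin j)
  where
  i : Fin (suc k)
  i = argmin c zero (allFin (suc k))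

⊆N-minimal-vertex : ∀ {m} (H : Graph (suc (suc m))) →
                    ∃ λ w → w ≢ zero × Neighbourhood.MinimalExcept H zero w
⊆N-minimal-vertex {m} H = suc i , (λ ()) , minimal
  where
  open Neighbourhood H
  size : Fin (suc m) → ℕ
  size j = ∣ N[ suc j ] ∣
  minimiser : ∃ λ i → ∀ j → size i ≤ℕ size j
  minimiser = ∃-minimiser size
  i : Fin (suc m)
  i = proj₁ minimiser
  minimal : MinimalExcept zero (suc i)
  minimal zero    x≢0 _   = ⊥-elim (x≢0 refl)
  minimal (suc j) _   j⊆i = decidable-stable (suc i ⊆N? suc j) λ i⊈j →
    let z , z∈Ni , z∉Nj = ⊈N⇒∃ i⊈j in <⇒≱ (⊆N-∣N∣-< j⊆i z∈Ni z∉Nj) (proj₂ minimiser j)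

module MinimalNeighbourhood
  (H : Graph n) (free : LowerSwitching C5coC6Free H)
  {v₀ : Fin n} (v₀-isolated : Isolated H v₀)
  {w : Fin n} (w≢v₀ : w ≢ v₀) (w-minimal : Neighbourhood.MinimalExcept H v₀ w)
  where

  open Neighbourhood H

  P4-free : P4Free H
  P4-free = isolated⇒P4-free H free v₀-isolated

  ≢v₀ : ∀ {x y} → H ⊢ x ~ y → x ≢ v₀
  ≢v₀ xy = ≢-sym (isolated-≢ H v₀-isolated xy)

  private-neighbour : ∀ {x r} → H ⊢ w ~ x → H ⊢ w ~ r → H ⊢ x ≁ r → x ≢ r →
                      ∃ λ y → H ⊢ x ~ y × H ⊢ y ~ r × H ⊢ w ≁ y × w ≢ y
  private-neighbour {x} {r} wx wr xr x≢r with x ⊆N? w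
  ... | yes x⊆w =
    ⊥-elim ([ x≢r , (λ xr′ → ~-≁-contradiction H xr′ xr) ] (w-minimal x (≢v₀ (~-sym H wx)) x⊆w r (inj₂ wr)))
  ... | no x⊈w with ⊈N⇒∃ x⊈w
  ...   | y , y∈Nx , y∉Nw = y , xy , yr , wy , ∉N⇒≢ y∉Nw
    where
    xy : H ⊢ x ~ y
    xy = ∈N⇒~ y∈Nx λ x≡y → y∉Nw (inj₂ (subst (H ⊢ w ~_) x≡y wx))
    wy : H ⊢ w ≁ y
    wy = ∉N⇒≁ y∉Nw
    yr : H ⊢ y ~ r
    yr = ¬-not λ yr → P4-free (induced-P4 (~-sym H xy) (~-sym H wx) wr (≁-sym H wy) yr xr)

  P₃-dominates : ∀ {p r e} → H ⊢ w ~ p → H ⊢ w ~ r → H ⊢ p ≁ r → p ≢ r → e ≢ v₀ →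
                 All (H ⊢ e ≁_) (p ∷ w ∷ r ∷ []) → ⊥
  P₃-dominates {p} {r} {e} wp wr pr p≢r e≢v₀ (ep ∷ ew ∷ er ∷ []) with private-neighbour wp wr pr p≢r
  ... | y , py , yr , wy , w≢y with adj H e y in ey
  ...   | true  = P4-free (induced-P4 ey (~-sym H py) (~-sym H wp) ep ew (≁-sym H wy))
  ...   | false = isolated⇒C4+K1-free H free v₀-isolated
                    (induced-C4 (~-sym H py) (~-sym H wp) wr (~-sym H yr) (≁-sym H wy) pr (≢-sym w≢y) p≢r)
                    (ey ∷ ep ∷ ew ∷ er ∷ []) e≢v₀

  no-C4-in-N[w] : ∀ {p q r s} → InducedC4 H p q r s → All (H ⊢ w ~_) (p ∷ q ∷ r ∷ s ∷ []) → ⊥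
  no-C4-in-N[w] {p} {q} {r} {s} c4@(induced-C4 pq qr rs sp pr qs p≢r q≢s) w~pqrs@(wp ∷ wq ∷ wr ∷ ws ∷ [])
    with private-neighbour wp wr pr p≢r | private-neighbour wq ws qs q≢s
  ... | y , py , yr , wy , w≢y | z , qz , zs , wz , w≢z with adj H y q in yq | adj H y s in ys
  ...   | true  | true  = K222-free H free c4 w~pqrs (~-sym H py ∷ yq ∷ yr ∷ ys ∷ []) wy w≢y
  ...   | true  | false = P4-free (induced-P4 yq (~-sym H wq) ws (≁-sym H wy) ys qs)
  ...   | false | true  = P4-free (induced-P4 ys (~-sym H ws) wq (≁-sym H wy) yq (≁-sym H qs))
  ...   | false | false with adj H z p in zp | adj H z r in zr
  ...     | true  | true  = K222-free H free (induced-C4 qr rs sp pq qs (≁-sym H pr) q≢s (≢-sym p≢r))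
                              (wq ∷ wr ∷ ws ∷ wp ∷ []) (~-sym H qz ∷ zr ∷ zs ∷ zp ∷ []) wz w≢z
  ...     | true  | false = P4-free (induced-P4 zp (~-sym H wp) wr (≁-sym H wz) zr pr)
  ...     | false | true  = P4-free (induced-P4 zr (~-sym H wr) wp (≁-sym H wz) zp (≁-sym H pr))
  ...     | false | false with adj H y z in yz
  ...       | true  = P4-free (induced-P4 wp py yz wy wz (≁-sym H zp))
  ...       | false = P4-free (induced-P4 (~-sym H py) pq qz yq yz (≁-sym H zp))

  either-≢v₀ : ∀ {x y} → x ≢ y → x ≢ v₀ ⊎ y ≢ v₀
  either-≢v₀ {x} x≢y with x ≟ v₀
  ... | yes refl = inj₂ (≢-sym x≢y)
  ... | no x≢v₀  = inj₁ x≢v₀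

  module _ (K : Graph n) (K≈ : isolate H w ≈ K) where

    H-edge : ∀ {x y b c d} → adj K x y ≡ b → adj H w x ≡ c → adj H w y ≡ d → adj H x y ≡ b xor (c xor d)
    H-edge {x} {y} {b} {c} {d} Kxy wx wy = begin
      adj H x y                ≡⟨ xor-cancelʳ (adj H x y) σ ⟨
      (adj H x y xor σ) xor σ  ≡⟨ cong (_xor σ) (trans (sym (K≈ x y)) (adj-switch H (adj H w) x y)) ⟨
      adj K x y xor σ          ≡⟨ cong₂ _xor_ Kxy (cong₂ _xor_ wx wy) ⟩
      b xor (c xor d)          ∎
      where
      open ≡-Reasoning
      σ : Bool
      σ = adj H w x xor adj H w y

    same-side-C4 : ∀ {p q r s b} → InducedC4 K p q r s →
                   adj H w p ≡ b → adj H w q ≡ b → adj H w r ≡ b → adj H w s ≡ b → InducedC4 H p q r s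
    same-side-C4 {b = b} (induced-C4 pq qr rs sp pr qs p≢r q≢s) wp wq wr ws =
      induced-C4 (on-side pq wp wq) (on-side qr wq wr) (on-side rs wr ws) (on-side sp ws wp)
                 (on-side pr wp wr) (on-side qs wq ws) p≢r q≢s
      where
      on-side : ∀ {x y c} → adj K x y ≡ c → adj H w x ≡ b → adj H w y ≡ b → adj H x y ≡ c
      on-side {x} {y} Kxy wx wy =
        trans (sym (switch-same-side H (adj H w) (trans wx (sym wy)))) (trans (K≈ x y) Kxy)

    -- By N(w) ∩ {p, q, r, s}: none gives C₄ + K₁ with w; one, or two adjacent ones, give a P₄ through w;
    -- two opposite ones, or three, give a P₃ p – w – r missed by a vertex; all four give a C₄ inside N(w).
    C4-free : C4Free K
    C4-free {p} {q} {r} {s} c4@(induced-C4 pq qr rs sp pr qs p≢r q≢s)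
      with adj H w p in wp | adj H w q in wq | adj H w r in wr | adj H w s in ws
    ... | false | false | false | false =
      isolated⇒C4+K1-free H free v₀-isolated (same-side-C4 c4 wp wq wr ws) (wp ∷ wq ∷ wr ∷ ws ∷ []) w≢v₀
    ... | true  | false | false | false =
      P4-free (induced-P4 wp (H-edge pr wp wr) (~-sym H (H-edge qr wq wr)) wr wq (H-edge pq wp wq))
    ... | false | true  | false | false =
      P4-free (induced-P4 wq (H-edge qs wq ws) (~-sym H (H-edge rs wr ws)) ws wr (H-edge qr wq wr))
    ... | false | false | true  | false =
      P4-free (induced-P4 wr (~-sym H (H-edge pr wp wr)) (~-sym H (H-edge sp ws wp)) wp ws (H-edge rs wr ws))
    ... | false | false | false | true  =
      P4-free (induced-P4 ws (~-sym H (H-edge qs wq ws)) (~-sym H (H-edge pq wp wq)) wq wp (H-edge sp ws wp))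
    ... | true  | true  | false | false =
      P4-free (induced-P4 wp (H-edge pr wp wr) (H-edge rs wr ws) wr ws (≁-sym H (H-edge sp ws wp)))
    ... | false | true  | true  | false =
      P4-free (induced-P4 wq (H-edge qs wq ws) (H-edge sp ws wp) ws wp (≁-sym H (H-edge pq wp wq)))
    ... | false | false | true  | true  =
      P4-free (induced-P4 wr (~-sym H (H-edge pr wp wr)) (H-edge pq wp wq) wp wq (≁-sym H (H-edge qr wq wr)))
    ... | true  | false | false | true  =
      P4-free (induced-P4 ws (~-sym H (H-edge qs wq ws)) (H-edge qr wq wr) wq wr (≁-sym H (H-edge rs wr ws)))
    ... | true  | false | true  | false = [
      (λ q≢v₀ → P₃-dominates wp wr (H-edge pr wp wr) p≢r q≢v₀
                  (≁-sym H (H-edge pq wp wq) ∷ ≁-sym H wq ∷ H-edge qr wq wr ∷ [])) ,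
      (λ s≢v₀ → P₃-dominates wp wr (H-edge pr wp wr) p≢r s≢v₀
                  (H-edge sp ws wp ∷ ≁-sym H ws ∷ ≁-sym H (H-edge rs wr ws) ∷ [])) ] (either-≢v₀ q≢s)
    ... | false | true  | false | true  = [
      (λ p≢v₀ → P₃-dominates wq ws (H-edge qs wq ws) q≢s p≢v₀
                  (H-edge pq wp wq ∷ ≁-sym H wp ∷ ≁-sym H (H-edge sp ws wp) ∷ [])) ,
      (λ r≢v₀ → P₃-dominates wq ws (H-edge qs wq ws) q≢s r≢v₀
                  (≁-sym H (H-edge qr wq wr) ∷ ≁-sym H wr ∷ H-edge rs wr ws ∷ [])) ] (either-≢v₀ p≢r)
    ... | true  | true  | true  | false =
      P₃-dominates wp wr (H-edge pr wp wr) p≢r (≢v₀ (~-sym H (H-edge qs wq ws)))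
        (H-edge sp ws wp ∷ ≁-sym H ws ∷ ≁-sym H (H-edge rs wr ws) ∷ [])
    ... | false | true  | true  | true  =
      P₃-dominates wq ws (H-edge qs wq ws) q≢s (≢v₀ (H-edge pr wp wr))
        (H-edge pq wp wq ∷ ≁-sym H wp ∷ ≁-sym H (H-edge sp ws wp) ∷ [])
    ... | true  | false | true  | true  =
      P₃-dominates wr wp (≁-sym H (H-edge pr wp wr)) (≢-sym p≢r) (≢v₀ (H-edge qs wq ws))
        (H-edge qr wq wr ∷ ≁-sym H wq ∷ ≁-sym H (H-edge pq wp wq) ∷ [])
    ... | true  | true  | false | true  =
      P₃-dominates ws wq (≁-sym H (H-edge qs wq ws)) (≢-sym q≢s) (≢v₀ (~-sym H (H-edge pr wp wr)))
        (H-edge rs wr ws ∷ ≁-sym H wr ∷ ≁-sym H (H-edge qr wq wr) ∷ [])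
    ... | true  | true  | true  | true  =
      no-C4-in-N[w] (same-side-C4 c4 wp wq wr ws) (wp ∷ wq ∷ wr ∷ ws ∷ [])

edgeless-orientation : ∀ (G : Graph n) → (∀ u v → G ⊢ u ≁ v) → TransitiveOrientation G
edgeless-orientation G edgeless = record
  { arc      = λ _ _ → false
  ; arc⇒edge = λ _ _ ()
  ; edge⇒arc = λ u v uv → ⊥-elim (~-≁-contradiction G uv (edgeless u v))
  ; antisym  = λ _ _ ()
  ; trans    = λ _ _ _ ()
  }

free⇒comparability : ∀ {G : Graph n} → LowerSwitching C5coC6Free G → Comparability G
free⇒comparability {zero}        {G} _    = edgeless-orientation G λ ()
free⇒comparability {suc zero}    {G} _    = edgeless-orientation G λ { zero zero → irrfl G zero }
free⇒comparability {suc (suc m)} {G} free with ⊆N-minimal-vertex (isolate G zero)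
... | w , w≢0 , w-minimal = Lift.lifted-orientation G w ≺-orientation ≺-orientation-⊆N
  where
  K-C4-free : C4Free (isolate G w)
  K-C4-free = MinimalNeighbourhood.C4-free
                (isolate G zero) (LowerSwitching-switch G (adj G zero) free) (isolate-isolates G zero) w≢0 w-minimal
                (isolate G w) (isolate-switch G (adj G zero) w)
  K-P4-free : P4Free (isolate G w)
  K-P4-free = isolated⇒P4-free (isolate G w) (LowerSwitching-switch G (adj G w) free) (isolate-isolates G w)
  open TriviallyPerfect (isolate G w) K-P4-free K-C4-free

mainTheorem20 : (n : ℕ) (G : Graph n) →
    LowerSwitching Comparability G ⇔ LowerSwitching C5coC6Free G
mainTheorem20 n G = mk⇔
  (λ comparable A → comparability⇒C5coC6Free (switch G A) (comparable A))
  (λ free A → free⇒comparability (LowerSwitching-switch G A free))
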